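{- The covariant isotropy group of a crossed module $\partial:A\to G$, in the category $\mathsf{XMod}$ of crossed modules, is isomorphic to $G$.
   Context: A crossed module consists of groups $A$, $G$, an action of $G$ on $A$ by automorphisms and a homomorphism $\partial:A\to G$ that is equivariant for the conjugation action of $G$ on itself and satisfies the Peiffer identity $\partial(a)\cdot a'=aa'a^{ -1}$; morphisms are pairs of homomorphisms compatible with $\partial$ and the actions. For a category $\mathcal{E}$ and object $X$, the covariant isotropy group of $X$ is the group of natural automorphisms of the projection functor $X/\mathcal{E}\to\mathcal{E}$ (sending $X\to Y$ to $Y$), i.e. families of automorphisms $\alpha_m:Y\to Y$ for $m:X\to Y$ with $\alpha_{nm}\circ n=n\circ\alpha_m$ for every $n:Y\to Z$. -}

module Defs where

open import Level using (Level; _⊔_; suc)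
open import Function using (id; _∘_)
open import Algebra.Bundles using (Group; RawGroup)
open import Algebra.Morphism.Structures using (module GroupMorphisms)
import Algebra.Morphism.Construct.Identity as MId
import Algebra.Morphism.Construct.Composition as MComp
open import Data.Product using (_×_; _,_; proj₁; proj₂)

private
  variable
    c ℓ : Level

IsHom : (H K : Group c ℓ) → (Group.Carrier H → Group.Carrier K) → Set (c ⊔ ℓ)
IsHom H K = GroupMorphisms.IsGroupHomomorphism (Group.rawGroup H) (Group.rawGroup K)

record XMod (c ℓ : Level) : Set (suc (c ⊔ ℓ)) where
  field
    A : Group c ℓ
    G : Group c ℓ
  module A = Group A
  module G = Group G
  field
    act      : G.Carrier → A.Carrier → A.Carrier
    act-cong : ∀ {g g' a a'} → g G.≈ g' → a A.≈ a' → act g a A.≈ act g' a'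
    act-hom  : ∀ g a a' → act g (a A.∙ a') A.≈ (act g a A.∙ act g a')
    act-ε    : ∀ a → act G.ε a A.≈ a
    act-∙    : ∀ g h a → act (g G.∙ h) a A.≈ act g (act h a)
    ∂        : A.Carrier → G.Carrier
    ∂-hom    : IsHom A G ∂
    ∂-equiv  : ∀ g a → ∂ (act g a) G.≈ ((g G.∙ ∂ a) G.∙ (g G.⁻¹))
    peiffer  : ∀ a a' → act (∂ a) a' A.≈ ((a A.∙ a') A.∙ (a A.⁻¹))

record Hom {c ℓ : Level} (X Y : XMod c ℓ) : Set (c ⊔ ℓ) where
  private
    module X = XMod X
    module Y = XMod Y
  field
    fA      : X.A.Carrier → Y.A.Carrier
    fG      : X.G.Carrier → Y.G.Carrier
    fA-hom  : IsHom X.A Y.A fA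
    fG-hom  : IsHom X.G Y.G fG
    comm-∂  : ∀ a → Y.∂ (fA a) Y.G.≈ fG (X.∂ a)
    comm-act : ∀ g a → fA (X.act g a) Y.A.≈ Y.act (fG g) (fA a)

record _≈H_ {c ℓ : Level} {X Y : XMod c ℓ} (f g : Hom X Y) : Set (c ⊔ ℓ) where
  constructor _,_
  field
    ≈A : ∀ a → XMod.A._≈_ Y (Hom.fA f a) (Hom.fA g a)
    ≈G : ∀ x → XMod.G._≈_ Y (Hom.fG f x) (Hom.fG g x)
infix 4 _≈H_

idH : (X : XMod c ℓ) → Hom X X
idH X = record
  { fA = id
  ; fG = id
  ; fA-hom = MId.isGroupHomomorphism X.A.rawGroup X.A.refl
  ; fG-hom = MId.isGroupHomomorphism X.G.rawGroup X.G.refl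
  ; comm-∂ = λ a → X.G.refl
  ; comm-act = λ g a → X.A.refl
  }
  where module X = XMod X

_∘H_ : {X Y Z : XMod c ℓ} → Hom Y Z → Hom X Y → Hom X Z
_∘H_ {X = X} {Y} {Z} g f = record
  { fA = g.fA ∘ f.fA
  ; fG = g.fG ∘ f.fG
  ; fA-hom = MComp.isGroupHomomorphism Z.A.trans f.fA-hom g.fA-hom
  ; fG-hom = MComp.isGroupHomomorphism Z.G.trans f.fG-hom g.fG-hom
  ; comm-∂ = λ a → Z.G.trans (g.comm-∂ (f.fA a))
                     (GroupMorphisms.IsGroupHomomorphism.⟦⟧-cong g.fG-hom (f.comm-∂ a))
  ; comm-act = λ x a → Z.A.trans
                     (GroupMorphisms.IsGroupHomomorphism.⟦⟧-cong g.fA-hom (f.comm-act x a))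
                     (g.comm-act (f.fG x) (f.fA a))
  }
  where
    module Z = XMod Z
    module f = Hom f
    module g = Hom g
infixr 9 _∘H_

module _ {X Y : XMod c ℓ} where
  private
    module Y = XMod Y
  ≈H-refl : {f : Hom X Y} → f ≈H f
  ≈H-refl = (λ a → Y.A.refl) , (λ x → Y.G.refl)
  ≈H-sym : {f g : Hom X Y} → f ≈H g → g ≈H f
  ≈H-sym (p , q) = (λ a → Y.A.sym (p a)) , (λ x → Y.G.sym (q x))
  ≈H-trans : {f g h : Hom X Y} → f ≈H g → g ≈H h → f ≈H h
  ≈H-trans (p , q) (p' , q') = (λ a → Y.A.trans (p a) (p' a)) , (λ x → Y.G.trans (q x) (q' x))

∘H-cong : {X Y Z : XMod c ℓ} {g g' : Hom Y Z} {f f' : Hom X Y} →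
          g ≈H g' → f ≈H f' → g ∘H f ≈H g' ∘H f'
∘H-cong {Z = Z} {g} {g'} {f} {f'} (p , q) (p' , q') =
    (λ a → Z.A.trans (GroupMorphisms.IsGroupHomomorphism.⟦⟧-cong (Hom.fA-hom g) (p' a)) (p (Hom.fA f' a)))
  , (λ x → Z.G.trans (GroupMorphisms.IsGroupHomomorphism.⟦⟧-cong (Hom.fG-hom g) (q' x)) (q (Hom.fG f' x)))
  where module Z = XMod Z

∘H-assoc : {W X Y Z : XMod c ℓ} (h : Hom Y Z) (g : Hom X Y) (f : Hom W X) →
           (h ∘H g) ∘H f ≈H h ∘H (g ∘H f)
∘H-assoc {Z = Z} h g f = (λ a → XMod.A.refl Z) , (λ x → XMod.G.refl Z)

∘H-idˡ : {X Y : XMod c ℓ} (f : Hom X Y) → idH Y ∘H f ≈H f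
∘H-idˡ {Y = Y} f = (λ a → XMod.A.refl Y) , (λ x → XMod.G.refl Y)
∘H-idʳ : {X Y : XMod c ℓ} (f : Hom X Y) → f ∘H idH X ≈H f
∘H-idʳ {Y = Y} f = (λ a → XMod.A.refl Y) , (λ x → XMod.G.refl Y)

-- An element of the covariant isotropy group of X in XMod c ℓ:
-- a natural automorphism of the projection functor X/XMod → XMod,
-- i.e. for each m : X → Y an automorphism α m : Y → Y (with inverse
-- α⁻¹ m), such that  α (n ∘ m) ∘ n ≈ n ∘ α m  for every n : Y → Z.
-- Since hom-sets are setoids, the families are required to respect
-- equality of morphisms.  The fields α⁻¹-cong and α⁻¹-natural are
-- consequences of the others (the inverse of a natural iso is natural)
-- and are included only for convenience.
record Isotropy {c ℓ : Level} (X : XMod c ℓ) : Set (suc (c ⊔ ℓ)) where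
  field
    α        : {Y : XMod c ℓ} → Hom X Y → Hom Y Y
    α⁻¹      : {Y : XMod c ℓ} → Hom X Y → Hom Y Y
    α-cong   : {Y : XMod c ℓ} {m m' : Hom X Y} → m ≈H m' → α m ≈H α m'
    α⁻¹-cong : {Y : XMod c ℓ} {m m' : Hom X Y} → m ≈H m' → α⁻¹ m ≈H α⁻¹ m'
    inv-l    : {Y : XMod c ℓ} (m : Hom X Y) → α⁻¹ m ∘H α m ≈H idH Y
    inv-r    : {Y : XMod c ℓ} (m : Hom X Y) → α m ∘H α⁻¹ m ≈H idH Y
    natural  : {Y Z : XMod c ℓ} (m : Hom X Y) (n : Hom Y Z) →
               α (n ∘H m) ∘H n ≈H n ∘H α m
    α⁻¹-natural : {Y Z : XMod c ℓ} (m : Hom X Y) (n : Hom Y Z) →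
               α⁻¹ (n ∘H m) ∘H n ≈H n ∘H α⁻¹ m

module _ {c ℓ : Level} (X : XMod c ℓ) where
  open Isotropy

  _≈I_ : Isotropy X → Isotropy X → Set (suc (c ⊔ ℓ))
  φ ≈I ψ = {Y : XMod c ℓ} (m : Hom X Y) → α φ m ≈H α ψ m

  _∙I_ : Isotropy X → Isotropy X → Isotropy X
  φ ∙I ψ = record
    { α = λ m → α φ m ∘H α ψ m
    ; α⁻¹ = λ m → α⁻¹ ψ m ∘H α⁻¹ φ m
    ; α-cong = λ e → ∘H-cong (α-cong φ e) (α-cong ψ e)
    ; α⁻¹-cong = λ e → ∘H-cong (α⁻¹-cong ψ e) (α⁻¹-cong φ e)
    ; inv-l = λ m →
        let a = α φ m ; b = α ψ m ; a' = α⁻¹ φ m ; b' = α⁻¹ ψ m in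
        ≈H-trans (∘H-assoc b' a' (a ∘H b))
        (≈H-trans (∘H-cong (≈H-refl {f = b'}) (≈H-sym (∘H-assoc a' a b)))
        (≈H-trans (∘H-cong (≈H-refl {f = b'}) (∘H-cong (inv-l φ m) (≈H-refl {f = b})))
        (≈H-trans (∘H-cong (≈H-refl {f = b'}) (∘H-idˡ b))
        (inv-l ψ m))))
    ; inv-r = λ m →
        let a = α φ m ; b = α ψ m ; a' = α⁻¹ φ m ; b' = α⁻¹ ψ m in
        ≈H-trans (∘H-assoc a b (b' ∘H a'))
        (≈H-trans (∘H-cong (≈H-refl {f = a}) (≈H-sym (∘H-assoc b b' a')))
        (≈H-trans (∘H-cong (≈H-refl {f = a}) (∘H-cong (inv-r ψ m) (≈H-refl {f = a'})))
        (≈H-trans (∘H-cong (≈H-refl {f = a}) (∘H-idˡ a'))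
        (inv-r φ m))))
    ; natural = λ m n →
        ≈H-trans (∘H-assoc (α φ (n ∘H m)) (α ψ (n ∘H m)) n)
        (≈H-trans (∘H-cong (≈H-refl {f = α φ (n ∘H m)}) (natural ψ m n))
        (≈H-trans (≈H-sym (∘H-assoc (α φ (n ∘H m)) n (α ψ m)))
        (≈H-trans (∘H-cong (natural φ m n) (≈H-refl {f = α ψ m}))
        (∘H-assoc n (α φ m) (α ψ m)))))
    ; α⁻¹-natural = λ m n →
        ≈H-trans (∘H-assoc (α⁻¹ ψ (n ∘H m)) (α⁻¹ φ (n ∘H m)) n)
        (≈H-trans (∘H-cong (≈H-refl {f = α⁻¹ ψ (n ∘H m)}) (α⁻¹-natural φ m n))
        (≈H-trans (≈H-sym (∘H-assoc (α⁻¹ ψ (n ∘H m)) n (α⁻¹ φ m)))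
        (≈H-trans (∘H-cong (α⁻¹-natural ψ m n) (≈H-refl {f = α⁻¹ φ m}))
        (∘H-assoc n (α⁻¹ ψ m) (α⁻¹ φ m)))))
    }

  εI : Isotropy X
  εI = record
    { α = λ {Y} _ → idH Y
    ; α⁻¹ = λ {Y} _ → idH Y
    ; α-cong = λ _ → ≈H-refl
    ; α⁻¹-cong = λ _ → ≈H-refl
    ; inv-l = λ {Y} _ → ∘H-idˡ (idH Y)
    ; inv-r = λ {Y} _ → ∘H-idˡ (idH Y)
    ; natural = λ _ n → ≈H-trans (∘H-idˡ n) (≈H-sym (∘H-idʳ n))
    ; α⁻¹-natural = λ _ n → ≈H-trans (∘H-idˡ n) (≈H-sym (∘H-idʳ n))
    }

  _⁻¹I : Isotropy X → Isotropy X
  φ ⁻¹I = record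
    { α = α⁻¹ φ
    ; α⁻¹ = α φ
    ; α-cong = α⁻¹-cong φ
    ; α⁻¹-cong = α-cong φ
    ; inv-l = inv-r φ
    ; inv-r = inv-l φ
    ; natural = α⁻¹-natural φ
    ; α⁻¹-natural = natural φ
    }

  IsotropyGroup : RawGroup (suc (c ⊔ ℓ)) (suc (c ⊔ ℓ))
  IsotropyGroup = record
    { Carrier = Isotropy X
    ; _≈_ = _≈I_
    ; _∙_ = _∙I_
    ; ε = εI
    ; _⁻¹ = _⁻¹I
    }

-- An element g of G acts on each m : X → Y by the inner automorphism of Y given by m g, and this
-- is an injective homomorphism from G into the isotropy group.  Conversely, let α be in the
-- isotropy group.  At the zero morphisms X → Y, α is a natural automorphism of the identity
-- functor of XMod, and such an automorphism is trivial: it fixes the generator of the crossed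
-- module 1 → ℤ₂, hence every involution of every G, hence every element h of every G, because
-- (h⁻¹, h) is a product of two involutions in the wreath product G ≀ ℤ₂, and finally every
-- element of A, through the crossed module id : A → A.  Now embed X into the first base factor
-- of X ≀ ℤ₂ and let q be the second base coordinate of the image under α of the swap σ.  Since
-- σ conjugates (h, 1) to (1, h), naturality forces α m to be the inner automorphism by m (q⁻¹).

module Submission where

open import Level using (Level; _⊔_; Lift; lift; lower)
open import Data.Bool using (Bool; true; false; _xor_)
open import Data.Bool.Properties using (xor-assoc; xor-identityʳ; xor-same)
open import Data.Product using (Σ; _×_; _,_; proj₁; proj₂; swap)
open import Data.Product.Relation.Binary.Pointwise.NonDependent using (Pointwise)
open import Relation.Binary.PropositionalEquality using (_≡_; refl; cong₂)
  renaming (sym to ≡-sym; trans to ≡-trans)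
open import Algebra.Bundles using (Group)
open import Function.Definitions using (Injective; Surjective)
open import Algebra.Morphism.Structures using (module GroupMorphisms)
import Algebra.Construct.DirectProduct as DirectProduct
import Algebra.Construct.Terminal as Terminal
import Algebra.Properties.Group as GroupProperties
import Algebra.Properties.Monoid as MonoidProperties
import Relation.Binary.Reasoning.Setoid as SetoidReasoning
open import Defs

private
  variable
    c ℓ : Level

∙-homo⇒IsHom : (H K : Group c ℓ) {f : Group.Carrier H → Group.Carrier K} →
  (∀ {x y} → Group._≈_ H x y → Group._≈_ K (f x) (f y)) →
  (∀ x y → Group._≈_ K (f (Group._∙_ H x y)) (Group._∙_ K (f x) (f y))) →
  IsHom H K f
∙-homo⇒IsHom H K {f} f-cong f-homo = record
  { isMonoidHomomorphism = record
    { isMagmaHomomorphism = record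
      { isRelHomomorphism = record { cong = f-cong }
      ; homo = f-homo }
    ; ε-homo = f-ε }
  ; ⁻¹-homo = λ x → K.inverseˡ-unique (f (x H.⁻¹)) (f x)
      (K.trans (K.sym (f-homo (x H.⁻¹) x)) (K.trans (f-cong (H.inverseˡ x)) f-ε)) }
  where
    module H = Group H
    module K where
      open Group K public
      open GroupProperties K public
    f-ε : f H.ε K.≈ K.ε
    f-ε = K.identityʳ-unique (f H.ε) (f H.ε)
      (K.trans (K.sym (f-homo H.ε H.ε)) (f-cong (H.identityˡ H.ε)))

record IsAutAction (K N : Group c ℓ)
  (_▹_ : Group.Carrier K → Group.Carrier N → Group.Carrier N) : Set (c ⊔ ℓ) where
  private
    module K = Group K
    module N = Group N
  field
    ▹-cong     : ∀ {k k' n n'} → k K.≈ k' → n N.≈ n' → (k ▹ n) N.≈ (k' ▹ n')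
    ▹-homo     : ∀ k n n' → (k ▹ (n N.∙ n')) N.≈ ((k ▹ n) N.∙ (k ▹ n'))
    ▹-identity : ∀ n → (K.ε ▹ n) N.≈ n
    ▹-∙        : ∀ k k' n → ((k K.∙ k') ▹ n) N.≈ (k ▹ (k' ▹ n))

  ▹-ε : ∀ k → (k ▹ N.ε) N.≈ N.ε
  ▹-ε k = GroupProperties.identityʳ-unique N (k ▹ N.ε) (k ▹ N.ε)
    (N.trans (N.sym (▹-homo k N.ε N.ε)) (▹-cong K.refl (N.identityˡ N.ε)))

  ▹-inverseˡ : ∀ k n → ((k K.⁻¹) ▹ (k ▹ n)) N.≈ n
  ▹-inverseˡ k n = N.trans (N.sym (▹-∙ (k K.⁻¹) k n))
    (N.trans (▹-cong (K.inverseˡ k) N.refl) (▹-identity n))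

  ▹-inverseʳ : ∀ k n → (k ▹ ((k K.⁻¹) ▹ n)) N.≈ n
  ▹-inverseʳ k n = N.trans (N.sym (▹-∙ k (k K.⁻¹) n))
    (N.trans (▹-cong (K.inverseʳ k) N.refl) (▹-identity n))

module Conjugation (H : Group c ℓ) where
  open Group H
  open GroupProperties H using (⁻¹-anti-homo-∙; ε⁻¹≈ε)
  open MonoidProperties monoid using (cancelʳ)
  open SetoidReasoning setoid

  conj : Carrier → Carrier → Carrier
  conj h x = h ∙ x ∙ h ⁻¹

  conj-isAutAction : IsAutAction H H conj
  conj-isAutAction = record
    { ▹-cong = λ h≈h' x≈x' → ∙-cong (∙-cong h≈h' x≈x') (⁻¹-cong h≈h')
    ; ▹-homo = homo
    ; ▹-identity = λ x → trans (∙-cong (identityˡ x) ε⁻¹≈ε) (identityʳ x)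
    ; ▹-∙ = compose }
    where
      homo : ∀ h x y → conj h (x ∙ y) ≈ conj h x ∙ conj h y
      homo h x y = begin
        h ∙ (x ∙ y) ∙ h ⁻¹               ≈⟨ ∙-congʳ (sym (assoc h x y)) ⟩
        h ∙ x ∙ y ∙ h ⁻¹                 ≈⟨ ∙-congʳ (∙-congʳ (sym (cancelʳ (inverseˡ h) (h ∙ x)))) ⟩
        h ∙ x ∙ h ⁻¹ ∙ h ∙ y ∙ h ⁻¹      ≈⟨ ∙-congʳ (assoc (h ∙ x ∙ h ⁻¹) h y) ⟩
        h ∙ x ∙ h ⁻¹ ∙ (h ∙ y) ∙ h ⁻¹    ≈⟨ assoc (h ∙ x ∙ h ⁻¹) (h ∙ y) (h ⁻¹) ⟩
        conj h x ∙ conj h y              ∎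
      compose : ∀ h k x → conj (h ∙ k) x ≈ conj h (conj k x)
      compose h k x = begin
        h ∙ k ∙ x ∙ (h ∙ k) ⁻¹           ≈⟨ ∙-cong (assoc h k x) (⁻¹-anti-homo-∙ h k) ⟩
        h ∙ (k ∙ x) ∙ (k ⁻¹ ∙ h ⁻¹)      ≈⟨ sym (assoc (h ∙ (k ∙ x)) (k ⁻¹) (h ⁻¹)) ⟩
        h ∙ (k ∙ x) ∙ k ⁻¹ ∙ h ⁻¹        ≈⟨ ∙-congʳ (assoc h (k ∙ x) (k ⁻¹)) ⟩
        conj h (conj k x)                ∎

  open IsAutAction conj-isAutAction public
    renaming (▹-cong to conj-cong; ▹-homo to conj-homo; ▹-identity to conj-identity;
              ▹-∙ to conj-∙; ▹-inverseˡ to conj-inverseˡ)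
    using ()

ℤ₂ : Group c ℓ
ℤ₂ {c} {ℓ} = record
  { Carrier = Lift c Bool
  ; _≈_ = λ x y → Lift ℓ (lower x ≡ lower y)
  ; _∙_ = λ x y → lift (lower x xor lower y)
  ; ε = lift false
  ; _⁻¹ = λ x → x
  ; isGroup = record
    { isMonoid = record
      { isSemigroup = record
        { isMagma = record
          { isEquivalence = record
            { refl = lift refl
            ; sym = λ { (lift e) → lift (≡-sym e) }
            ; trans = λ { (lift e) (lift f) → lift (≡-trans e f) } }
          ; ∙-cong = λ { (lift e) (lift f) → lift (cong₂ _xor_ e f) } }
        ; assoc = λ x y z → lift (xor-assoc (lower x) (lower y) (lower z)) }
      ; identity = (λ x → lift refl) , (λ x → lift (xor-identityʳ (lower x))) }
    ; inverse = (λ x → lift (xor-same (lower x))) , (λ x → lift (xor-same (lower x)))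
    ; ⁻¹-cong = λ e → e } }

module _ (N K : Group c ℓ) {_▹_ : Group.Carrier K → Group.Carrier N → Group.Carrier N}
  (isAutAction : IsAutAction K N _▹_) where
  private
    module N = Group N
    module K = Group K
    open IsAutAction isAutAction

  semidirectProduct : Group c ℓ
  semidirectProduct = record
    { Carrier = N.Carrier × K.Carrier
    ; _≈_ = Pointwise N._≈_ K._≈_
    ; _∙_ = λ { (n , k) (n' , k') → n N.∙ (k ▹ n') , k K.∙ k' }
    ; ε = N.ε , K.ε
    ; _⁻¹ = λ { (n , k) → (k K.⁻¹) ▹ (n N.⁻¹) , k K.⁻¹ }
    ; isGroup = record
      { isMonoid = record
        { isSemigroup = record
          { isMagma = record
            { isEquivalence = record
              { refl = N.refl , K.refl
              ; sym = λ { (e , f) → N.sym e , K.sym f }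
              ; trans = λ { (e , f) (e' , f') → N.trans e e' , K.trans f f' } }
            ; ∙-cong = λ { (e , f) (e' , f') → N.∙-cong e (▹-cong f e') , K.∙-cong f f' } }
          ; assoc = λ { (n , k) (n' , k') (n'' , k'') → assoc n k n' k' n'' , K.assoc k k' k'' } }
        ; identity = (λ { (n , k) → N.trans (N.identityˡ _) (▹-identity n) , K.identityˡ k })
                   , (λ { (n , k) → N.trans (N.∙-congˡ (▹-ε k)) (N.identityʳ n) , K.identityʳ k }) }
      ; inverse = (λ { (n , k) → inverseˡ n k , K.inverseˡ k })
                , (λ { (n , k) → N.trans (N.∙-congˡ (▹-inverseʳ k (n N.⁻¹))) (N.inverseʳ n)
                               , K.inverseʳ k })
      ; ⁻¹-cong = λ { (e , f) → ▹-cong (K.⁻¹-cong f) (N.⁻¹-cong e) , K.⁻¹-cong f } } }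
    where
      open SetoidReasoning N.setoid
      assoc : ∀ n k n' k' n'' →
        n N.∙ (k ▹ n') N.∙ ((k K.∙ k') ▹ n'') N.≈ n N.∙ (k ▹ (n' N.∙ (k' ▹ n'')))
      assoc n k n' k' n'' = begin
        n N.∙ (k ▹ n') N.∙ ((k K.∙ k') ▹ n'')   ≈⟨ N.assoc n (k ▹ n') _ ⟩
        n N.∙ ((k ▹ n') N.∙ ((k K.∙ k') ▹ n'')) ≈⟨ N.∙-congˡ (N.∙-congˡ (▹-∙ k k' n'')) ⟩
        n N.∙ ((k ▹ n') N.∙ (k ▹ (k' ▹ n'')))   ≈⟨ N.∙-congˡ (N.sym (▹-homo k n' (k' ▹ n''))) ⟩
        n N.∙ (k ▹ (n' N.∙ (k' ▹ n'')))         ∎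
      inverseˡ : ∀ n k → ((k K.⁻¹) ▹ (n N.⁻¹)) N.∙ ((k K.⁻¹) ▹ n) N.≈ N.ε
      inverseˡ n k = begin
        ((k K.⁻¹) ▹ (n N.⁻¹)) N.∙ ((k K.⁻¹) ▹ n) ≈⟨ N.sym (▹-homo (k K.⁻¹) (n N.⁻¹) n) ⟩
        (k K.⁻¹) ▹ (n N.⁻¹ N.∙ n)                ≈⟨ ▹-cong K.refl (N.inverseˡ n) ⟩
        (k K.⁻¹) ▹ N.ε                           ≈⟨ ▹-ε (k K.⁻¹) ⟩
        N.ε                                      ∎

swapIf : {A : Set c} → Bool → A × A → A × A
swapIf false p = p
swapIf true p = swap p

module _ (H : Group c ℓ) where
  private
    module H² = Group (DirectProduct.group H H)

  swap-isAutAction : IsAutAction ℤ₂ (DirectProduct.group H H) (λ k → swapIf (lower k))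
  swap-isAutAction = record
    { ▹-cong = λ { {lift false} (lift refl) e → e ; {lift true} (lift refl) e → swap e }
    ; ▹-homo = λ { (lift false) _ _ → H².refl ; (lift true) _ _ → H².refl }
    ; ▹-identity = λ _ → H².refl
    ; ▹-∙ = λ { (lift false) _ _ → H².refl ; (lift true) (lift false) _ → H².refl
              ; (lift true) (lift true) _ → H².refl } }

  wreathℤ₂ : Group c ℓ
  wreathℤ₂ = semidirectProduct (DirectProduct.group H H) ℤ₂ swap-isAutAction

  swap≀ : Group.Carrier wreathℤ₂
  swap≀ = (Group.ε H , Group.ε H) , lift true

module XModProperties (Y : XMod c ℓ) where
  open XMod Y public
  open GroupMorphisms.IsGroupHomomorphism ∂-hom public
    renaming (⟦⟧-cong to ∂-cong; homo to ∂-homo; ε-homo to ∂-ε)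
    using ()

  act-isAutAction : IsAutAction G A act
  act-isAutAction = record
    { ▹-cong = act-cong ; ▹-homo = act-hom ; ▹-identity = act-ε ; ▹-∙ = act-∙ }

  open IsAutAction act-isAutAction public
    renaming (▹-ε to act-resp-ε; ▹-inverseˡ to act-inverseˡ)
    using ()

module HomProperties {X Y : XMod c ℓ} (f : Hom X Y) where
  open Hom f public
  open GroupMorphisms.IsGroupHomomorphism fA-hom public
    renaming (⟦⟧-cong to fA-cong; homo to fA-homo; ε-homo to fA-ε)
    using ()
  open GroupMorphisms.IsGroupHomomorphism fG-hom public
    renaming (⟦⟧-cong to fG-cong; homo to fG-homo; ε-homo to fG-ε; ⁻¹-homo to fG-⁻¹)
    using ()

module _ {X Y : XMod c ℓ} where
  private
    module X = XModProperties X
    module Y = XModProperties Y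

  mkHom : (fA : X.A.Carrier → Y.A.Carrier) (fG : X.G.Carrier → Y.G.Carrier) →
    (∀ {a a'} → a X.A.≈ a' → fA a Y.A.≈ fA a') →
    (∀ a a' → fA (a X.A.∙ a') Y.A.≈ (fA a Y.A.∙ fA a')) →
    (∀ {g g'} → g X.G.≈ g' → fG g Y.G.≈ fG g') →
    (∀ g g' → fG (g X.G.∙ g') Y.G.≈ (fG g Y.G.∙ fG g')) →
    (∀ a → Y.∂ (fA a) Y.G.≈ fG (X.∂ a)) →
    (∀ g a → fA (X.act g a) Y.A.≈ Y.act (fG g) (fA a)) → Hom X Y
  mkHom fA fG fA-cong fA-homo fG-cong fG-homo comm-∂ comm-act = record
    { fA = fA ; fG = fG
    ; fA-hom = ∙-homo⇒IsHom X.A Y.A fA-cong fA-homo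
    ; fG-hom = ∙-homo⇒IsHom X.G Y.G fG-cong fG-homo
    ; comm-∂ = comm-∂ ; comm-act = comm-act }

  zeroH : Hom X Y
  zeroH = mkHom (λ _ → Y.A.ε) (λ _ → Y.G.ε)
    (λ _ → Y.A.refl) (λ _ _ → Y.A.sym (Y.A.identityˡ Y.A.ε))
    (λ _ → Y.G.refl) (λ _ _ → Y.G.sym (Y.G.identityˡ Y.G.ε))
    (λ _ → Y.∂-ε) (λ _ _ → Y.A.sym (Y.act-resp-ε Y.G.ε))

∘H-zeroʳ : {X Y Z : XMod c ℓ} (n : Hom Y Z) → n ∘H zeroH {X = X} ≈H zeroH
∘H-zeroʳ n = (λ _ → N.fA-ε) , (λ _ → N.fG-ε)
  where module N = HomProperties n

module _ {Y : XMod c ℓ} where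
  private
    module Y = XModProperties Y
    open Conjugation Y.G

  innerH : Y.G.Carrier → Hom Y Y
  innerH h = mkHom (Y.act h) (conj h)
    (Y.act-cong Y.G.refl) (Y.act-hom h) (conj-cong Y.G.refl) (conj-homo h)
    (Y.∂-equiv h) comm-act
    where
      open SetoidReasoning Y.A.setoid
      comm-act : ∀ g a → Y.act h (Y.act g a) Y.A.≈ Y.act (conj h g) (Y.act h a)
      comm-act g a = Y.A.sym (begin
        Y.act (h Y.G.∙ g Y.G.∙ h Y.G.⁻¹) (Y.act h a)
          ≈⟨ Y.act-∙ (h Y.G.∙ g) (h Y.G.⁻¹) _ ⟩
        Y.act (h Y.G.∙ g) (Y.act (h Y.G.⁻¹) (Y.act h a))
          ≈⟨ Y.act-cong Y.G.refl (Y.act-inverseˡ h a) ⟩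
        Y.act (h Y.G.∙ g) a
          ≈⟨ Y.act-∙ h g a ⟩
        Y.act h (Y.act g a)                                ∎)

  innerH-cong : ∀ {h h'} → h Y.G.≈ h' → innerH h ≈H innerH h'
  innerH-cong h≈h' = (λ a → Y.act-cong h≈h' Y.A.refl) , (λ g → conj-cong h≈h' Y.G.refl)

  innerH-∙ : ∀ h k → innerH h ∘H innerH k ≈H innerH (h Y.G.∙ k)
  innerH-∙ h k = (λ a → Y.A.sym (Y.act-∙ h k a)) , (λ g → Y.G.sym (conj-∙ h k g))

  innerH-ε : ∀ {h} → h Y.G.≈ Y.G.ε → innerH h ≈H idH Y
  innerH-ε h≈ε = (λ a → Y.A.trans (Y.act-cong h≈ε Y.A.refl) (Y.act-ε a))
               , (λ g → Y.G.trans (conj-cong h≈ε Y.G.refl) (conj-identity g))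

innerH-natural : {Y Z : XMod c ℓ} (n : Hom Y Z) (h : XMod.G.Carrier Y) →
  innerH (Hom.fG n h) ∘H n ≈H n ∘H innerH h
innerH-natural {Z = Z} n h = (λ a → Z.A.sym (N.comm-act h a))
  , (λ g → Z.G.sym (Z.G.trans (N.fG-homo _ _) (Z.G.∙-cong (N.fG-homo h g) (N.fG-⁻¹ h))))
  where
    module Z = XMod Z
    module N = HomProperties n

ℤ₂X : XMod c ℓ
ℤ₂X {c} {ℓ} = record
  { A = Terminal.group {c} {ℓ} ; G = ℤ₂
  ; act = λ _ a → a ; act-cong = λ _ e → e
  ; act-hom = λ _ _ _ → _ ; act-ε = λ _ → _ ; act-∙ = λ _ _ _ → _
  ; ∂ = λ _ → lift false
  ; ∂-hom = ∙-homo⇒IsHom Terminal.group ℤ₂ (λ _ → lift refl) (λ _ _ → lift refl)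
  ; ∂-equiv = λ { (lift false) _ → lift refl ; (lift true) _ → lift refl }
  ; peiffer = λ _ _ → _ }

module _ {Y : XMod c ℓ} where
  private
    module Y = XModProperties Y

  involutionH : (h : Y.G.Carrier) → h Y.G.∙ h Y.G.≈ Y.G.ε → Hom ℤ₂X Y
  involutionH h h²≈ε = mkHom (λ _ → Y.A.ε) (λ k → power (lower k))
    (λ _ → Y.A.refl) (λ _ _ → Y.A.sym (Y.A.identityˡ Y.A.ε))
    (λ { {lift k} (lift refl) → Y.G.refl }) (λ k k' → power-xor (lower k) (lower k'))
    (λ _ → Y.∂-ε) (λ _ _ → Y.A.sym (Y.act-resp-ε _))
    where
      power : Bool → Y.G.Carrier
      power false = Y.G.ε
      power true = h
      power-xor : ∀ k k' → power (k xor k') Y.G.≈ power k Y.G.∙ power k'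
      power-xor false k' = Y.G.sym (Y.G.identityˡ (power k'))
      power-xor true false = Y.G.sym (Y.G.identityʳ h)
      power-xor true true = Y.G.sym h²≈ε

module _ (Y Z : XMod c ℓ) where
  private
    module Y = XModProperties Y
    module Z = XModProperties Z

  _×X_ : XMod c ℓ
  _×X_ = record
    { A = DirectProduct.group Y.A Z.A
    ; G = DirectProduct.group Y.G Z.G
    ; act = λ { (g , h) (a , b) → Y.act g a , Z.act h b }
    ; act-cong = λ { (e , f) (e' , f') → Y.act-cong e e' , Z.act-cong f f' }
    ; act-hom = λ _ _ _ → Y.act-hom _ _ _ , Z.act-hom _ _ _
    ; act-ε = λ _ → Y.act-ε _ , Z.act-ε _
    ; act-∙ = λ _ _ _ → Y.act-∙ _ _ _ , Z.act-∙ _ _ _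
    ; ∂ = λ { (a , b) → Y.∂ a , Z.∂ b }
    ; ∂-hom = ∙-homo⇒IsHom (DirectProduct.group Y.A Z.A) (DirectProduct.group Y.G Z.G)
        (λ { (e , f) → Y.∂-cong e , Z.∂-cong f }) (λ _ _ → Y.∂-homo _ _ , Z.∂-homo _ _)
    ; ∂-equiv = λ _ _ → Y.∂-equiv _ _ , Z.∂-equiv _ _
    ; peiffer = λ _ _ → Y.peiffer _ _ , Z.peiffer _ _ }

module _ {Y Z : XMod c ℓ} where
  private
    module Y = XModProperties Y
    module Z = XModProperties Z

  π₁ : Hom (Y ×X Z) Y
  π₁ = mkHom proj₁ proj₁ proj₁ (λ _ _ → Y.A.refl) proj₁ (λ _ _ → Y.G.refl)
    (λ _ → Y.G.refl) (λ _ _ → Y.A.refl)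

  π₂ : Hom (Y ×X Z) Z
  π₂ = mkHom proj₂ proj₂ proj₂ (λ _ _ → Z.A.refl) proj₂ (λ _ _ → Z.G.refl)
    (λ _ → Z.G.refl) (λ _ _ → Z.A.refl)

  ⟨_,_⟩ : {X : XMod c ℓ} → Hom X Y → Hom X Z → Hom X (Y ×X Z)
  ⟨ f , g ⟩ = mkHom (λ a → F.fA a , G.fA a) (λ x → F.fG x , G.fG x)
    (λ e → F.fA-cong e , G.fA-cong e) (λ _ _ → F.fA-homo _ _ , G.fA-homo _ _)
    (λ e → F.fG-cong e , G.fG-cong e) (λ _ _ → F.fG-homo _ _ , G.fG-homo _ _)
    (λ a → F.comm-∂ a , G.comm-∂ a) (λ x a → F.comm-act x a , G.comm-act x a)
    where
      module F = HomProperties f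
      module G = HomProperties g

  π₁-⟨,⟩ : {X : XMod c ℓ} (f : Hom X Y) (g : Hom X Z) → π₁ ∘H ⟨ f , g ⟩ ≈H f
  π₁-⟨,⟩ f g = (λ _ → Y.A.refl) , (λ _ → Y.G.refl)

  π₂-⟨,⟩ : {X : XMod c ℓ} (f : Hom X Y) (g : Hom X Z) → π₂ ∘H ⟨ f , g ⟩ ≈H g
  π₂-⟨,⟩ f g = (λ _ → Z.A.refl) , (λ _ → Z.G.refl)

idXMod : Group c ℓ → XMod c ℓ
idXMod A = record
  { A = A ; G = A ; act = conj ; act-cong = conj-cong ; act-hom = conj-homo
  ; act-ε = conj-identity ; act-∙ = conj-∙
  ; ∂ = λ a → a ; ∂-hom = ∙-homo⇒IsHom A A (λ e → e) (λ _ _ → A.refl)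
  ; ∂-equiv = λ _ _ → A.refl ; peiffer = λ _ _ → A.refl }
  where
    module A = Group A
    open Conjugation A

boundaryH : (Y : XMod c ℓ) → Hom (idXMod (XMod.A Y)) Y
boundaryH Y = mkHom (λ a → a) Y.∂ (λ e → e) (λ _ _ → Y.A.refl) Y.∂-cong Y.∂-homo
  (λ _ → Y.G.refl) (λ a a' → Y.A.sym (Y.peiffer a a'))
  where module Y = XModProperties Y

module _ (Y : XMod c ℓ) where
  private
    module Y = XModProperties Y
    module Y² = XModProperties (Y ×X Y)
    module W = Group (wreathℤ₂ Y.G)

    act≀ : W.Carrier → Y².A.Carrier → Y².A.Carrier
    act≀ (p , k) b = Y².act p (swapIf (lower k) b)

    ∂≀ : Y².A.Carrier → W.Carrier
    ∂≀ b = Y².∂ b , lift false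

  _≀ℤ₂ : XMod c ℓ
  _≀ℤ₂ = record
    { A = Y².A ; G = wreathℤ₂ Y.G
    ; act = act≀
    ; act-cong = λ { {_ , lift false} (e , lift refl) f → Y².act-cong e f
                   ; {_ , lift true} (e , lift refl) f → Y².act-cong e (swap f) }
    ; act-hom = λ { (p , lift false) a a' → Y².act-hom p a a'
                  ; (p , lift true) a a' → Y².act-hom p (swap a) (swap a') }
    ; act-ε = Y².act-ε
    ; act-∙ = λ { (p , lift false) (q , k') a → Y².act-∙ p q (swapIf (lower k') a)
                ; (p , lift true) (q , lift false) a → Y².act-∙ p (swap q) (swap a)
                ; (p , lift true) (q , lift true) a → Y².act-∙ p (swap q) a }
    ; ∂ = ∂≀
    ; ∂-hom = ∙-homo⇒IsHom Y².A (wreathℤ₂ Y.G) (λ e → Y².∂-cong e , lift refl)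
        (λ a a' → Y².∂-homo a a' , lift refl)
    ; ∂-equiv = λ { (p , lift false) b → Y².∂-equiv p b , lift refl
                  ; (p , lift true) b → Y².∂-equiv p (swap b) , lift refl }
    ; peiffer = Y².peiffer }

  baseH : Hom (Y ×X Y) _≀ℤ₂
  baseH = mkHom (λ b → b) (λ p → p , lift false) (λ e → e) (λ _ _ → Y².A.refl)
    (λ e → e , lift refl) (λ _ _ → W.refl) (λ _ → W.refl) (λ _ _ → Y².A.refl)

  topH : Hom _≀ℤ₂ ℤ₂X
  topH = mkHom _ proj₂ _ _ proj₂ (λ _ _ → lift refl) (λ _ → lift refl) _

≀ℤ₂-map : {X Y : XMod c ℓ} → Hom X Y → Hom (X ≀ℤ₂) (Y ≀ℤ₂)
≀ℤ₂-map {X = X} {Y} m = mkHom Mm.fA (λ { (p , k) → Mm.fG p , k })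
  Mm.fA-cong Mm.fA-homo (λ { (e , f) → Mm.fG-cong e , f })
  (λ { (p , lift false) (q , k) → Mm.fG-homo p q , lift refl
     ; (p , lift true) (q , k) → Mm.fG-homo p (swap q) , lift refl })
  (λ a → Mm.comm-∂ a , lift refl)
  (λ { (p , lift false) a → Mm.comm-act p a
     ; (p , lift true) a → Mm.comm-act p (swap a) })
  where module Mm = HomProperties (⟨ m ∘H π₁ {Z = X} , m ∘H π₂ {Y = X} ⟩)

module NaturalAutomorphismOfIdentity
  (γ γ⁻¹ : {Y : XMod c ℓ} → Hom Y Y)
  (γ-natural : {Y Z : XMod c ℓ} (n : Hom Y Z) → γ ∘H n ≈H n ∘H γ)
  (γ⁻¹∘γ≈id : {Y : XMod c ℓ} → γ⁻¹ ∘H γ ≈H idH Y) where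

  private
    module Γ (Y : XMod c ℓ) = HomProperties (γ {Y})
    module Γ⁻¹ (Y : XMod c ℓ) = HomProperties (γ⁻¹ {Y})

  γ-fixes-generator : Group._≈_ (ℤ₂ {c} {ℓ}) (Γ.fG ℤ₂X (lift true)) (lift true)
  γ-fixes-generator with lower (Γ.fG ℤ₂X (lift true)) in eq
  ... | true = lift refl
  ... | false with ≡-trans (≡-sym (lower (_≈H_.≈G (γ⁻¹∘γ≈id {ℤ₂X}) (lift true))))
                   (lower (Group.trans (ℤ₂ {c} {ℓ}) (Γ⁻¹.fG-cong ℤ₂X (lift eq)) (Γ⁻¹.fG-ε ℤ₂X)))
  ...   | ()

  γ-fixes-involutions : (Y : XMod c ℓ) (h : XMod.G.Carrier Y) →
    XMod.G._≈_ Y (XMod.G._∙_ Y h h) (XMod.G.ε Y) → XMod.G._≈_ Y (Γ.fG Y h) h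
  γ-fixes-involutions Y h h²≈ε =
    XMod.G.trans Y (_≈H_.≈G (γ-natural ι) (lift true)) (ι.fG-cong γ-fixes-generator)
    where
      ι : Hom ℤ₂X Y
      ι = involutionH h h²≈ε
      module ι = HomProperties ι

  -- In Y ≀ ℤ₂ the base element (h⁻¹, h) is the product of the involutions ((h⁻¹, h), swap)
  -- and swap.
  γ-fixes-G : (Y : XMod c ℓ) (h : XMod.G.Carrier Y) → XMod.G._≈_ Y (Γ.fG Y h) h
  γ-fixes-G Y h =
    Y.G.trans (_≈H_.≈G (γ-natural (π₂ {Y = Y} {Z = Y})) x) (proj₂ (proj₁ γ-fixes-base))
    where
      module Y = XMod Y
      module W = Group (wreathℤ₂ Y.G)
      x : Y.G.Carrier × Y.G.Carrier
      x = h Y.G.⁻¹ , h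
      u σ : W.Carrier
      u = x , lift true
      σ = swap≀ Y.G
      u∙σ≈base : u W.∙ σ W.≈ (x , lift false)
      u∙σ≈base = (Y.G.identityʳ (h Y.G.⁻¹) , Y.G.identityʳ h) , lift refl
      γ-fixes-base : (Γ.fG (Y ×X Y) x , lift false) W.≈ (x , lift false)
      γ-fixes-base = begin
        Γ.fG (Y ×X Y) x , lift false     ≈⟨ _≈H_.≈G (γ-natural (baseH Y)) x ⟨
        Γ.fG (Y ≀ℤ₂) (x , lift false)    ≈⟨ Γ.fG-cong (Y ≀ℤ₂) u∙σ≈base ⟨
        Γ.fG (Y ≀ℤ₂) (u W.∙ σ)           ≈⟨ Γ.fG-homo (Y ≀ℤ₂) u σ ⟩
        Γ.fG (Y ≀ℤ₂) u W.∙ Γ.fG (Y ≀ℤ₂) σ ≈⟨ W.∙-cong (γ-fixes-involutions (Y ≀ℤ₂) u u²≈ε)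
                                                     (γ-fixes-involutions (Y ≀ℤ₂) σ σ²≈ε) ⟩
        u W.∙ σ                          ≈⟨ u∙σ≈base ⟩
        x , lift false                   ∎
        where
          open SetoidReasoning W.setoid
          u²≈ε : u W.∙ u W.≈ W.ε
          u²≈ε = (Y.G.inverseˡ h , Y.G.inverseʳ h) , lift refl
          σ²≈ε : σ W.∙ σ W.≈ W.ε
          σ²≈ε = (Y.G.identityˡ Y.G.ε , Y.G.identityˡ Y.G.ε) , lift refl

  -- The boundary morphism idXMod A → Y reduces the A-component of γ to a G-component.
  γ-fixes-A : (Y : XMod c ℓ) (b : XMod.A.Carrier Y) → XMod.A._≈_ Y (Γ.fA Y b) b
  γ-fixes-A Y b = XMod.A.trans Y (_≈H_.≈A (γ-natural (boundaryH Y)) b)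
    (XMod.A.trans Y (Hom.comm-∂ (γ {idXMod (XMod.A Y)}) b) (γ-fixes-G (idXMod (XMod.A Y)) b))

  γ≈idH : {Y : XMod c ℓ} → γ {Y} ≈H idH Y
  γ≈idH {Y} = γ-fixes-A Y , γ-fixes-G Y

ι₁ : {X Y : XMod c ℓ} → Hom X Y → Hom X (Y ≀ℤ₂)
ι₁ {Y = Y} m = baseH Y ∘H ⟨ m , zeroH {Y = Y} ⟩

module _ {X : XMod c ℓ} where
  private
    module X = XModProperties X

  innerIsotropy : X.G.Carrier → Isotropy X
  innerIsotropy g = record
    { α = λ m → innerH (Hom.fG m g)
    ; α⁻¹ = λ m → innerH (Hom.fG m (g X.G.⁻¹))
    ; α-cong = λ m≈m' → innerH-cong (_≈H_.≈G m≈m' g)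
    ; α⁻¹-cong = λ m≈m' → innerH-cong (_≈H_.≈G m≈m' (g X.G.⁻¹))
    ; inv-l = λ m → ≈H-trans (innerH-∙ _ _) (innerH-ε (image-inverse m (X.G.inverseˡ g)))
    ; inv-r = λ m → ≈H-trans (innerH-∙ _ _) (innerH-ε (image-inverse m (X.G.inverseʳ g)))
    ; natural = λ m n → innerH-natural n (Hom.fG m g)
    ; α⁻¹-natural = λ m n → innerH-natural n (Hom.fG m (g X.G.⁻¹)) }
    where
      image-inverse : {Y : XMod c ℓ} (m : Hom X Y) {x y : X.G.Carrier} → x X.G.∙ y X.G.≈ X.G.ε →
        XMod.G._≈_ Y (XMod.G._∙_ Y (Hom.fG m x) (Hom.fG m y)) (XMod.G.ε Y)
      image-inverse {Y} m {x} {y} xy≈ε =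
        XMod.G.trans Y (XMod.G.sym Y (M.fG-homo x y)) (XMod.G.trans Y (M.fG-cong xy≈ε) M.fG-ε)
        where module M = HomProperties m

module IsotropyProperties {X : XMod c ℓ} (φ : Isotropy X) where
  open Isotropy φ
  private
    module X = XModProperties X

  α-natural-≈ : {Y Z : XMod c ℓ} (m : Hom X Y) (n : Hom Y Z) {m' : Hom X Z} →
    n ∘H m ≈H m' → α m' ∘H n ≈H n ∘H α m
  α-natural-≈ m n nm≈m' = ≈H-trans (∘H-cong (α-cong (≈H-sym nm≈m')) ≈H-refl) (natural m n)

  α-zeroH≈idH : {Y : XMod c ℓ} → α (zeroH {Y = Y}) ≈H idH Y
  α-zeroH≈idH = NaturalAutomorphismOfIdentity.γ≈idH (α zeroH) (α⁻¹ zeroH)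
    (λ n → α-natural-≈ zeroH n (∘H-zeroʳ n)) (inv-l zeroH)

  α-⟨,zeroH⟩ : {Y : XMod c ℓ} (m : Hom X Y) →
    α ⟨ m , zeroH {Y = Y} ⟩ ≈H ⟨ α m ∘H π₁ {Y = Y} {Z = Y} , π₂ {Y = Y} {Z = Y} ⟩
  α-⟨,zeroH⟩ {Y} m =
      (λ b → Y.A.sym (_≈H_.≈A first b)
           , Y.A.trans (Y.A.sym (_≈H_.≈A second b)) (_≈H_.≈A (α-zeroH≈idH {Y}) (proj₂ b)))
    , (λ g → Y.G.sym (_≈H_.≈G first g)
           , Y.G.trans (Y.G.sym (_≈H_.≈G second g)) (_≈H_.≈G (α-zeroH≈idH {Y}) (proj₂ g)))
    where
      module Y = XMod Y
      zero : Hom X Y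
      zero = zeroH
      p₁ p₂ : Hom (Y ×X Y) Y
      p₁ = π₁ {Y = Y} {Z = Y}
      p₂ = π₂ {Y = Y} {Z = Y}
      m×0 : Hom X (Y ×X Y)
      m×0 = ⟨ m , zero ⟩
      first : α m ∘H p₁ ≈H p₁ ∘H α m×0
      first = α-natural-≈ m×0 p₁ (π₁-⟨,⟩ m zero)
      second : α zero ∘H p₂ ≈H p₂ ∘H α m×0
      second = α-natural-≈ m×0 p₂ (π₂-⟨,⟩ m zero)

  α-ι₁-base : {Y : XMod c ℓ} (m : Hom X Y) →
    α (ι₁ {Y = Y} m) ∘H baseH Y ≈H baseH Y ∘H ⟨ α m ∘H π₁ {Y = Y} {Z = Y} , π₂ {Y = Y} {Z = Y} ⟩
  α-ι₁-base {Y} m =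
    ≈H-trans (natural ⟨ m , zeroH {Y = Y} ⟩ base) (∘H-cong (≈H-refl {f = base}) (α-⟨,zeroH⟩ m))
    where
      base : Hom (Y ×X Y) (Y ≀ℤ₂)
      base = baseH Y

  α-ι₁-top : {Y : XMod c ℓ} (m : Hom X Y) →
    Group._≈_ (ℤ₂ {c} {ℓ}) (proj₂ (Hom.fG (α (ι₁ m)) (swap≀ (XMod.G Y)))) (lift true)
  α-ι₁-top {Y} m = Group.trans (ℤ₂ {c} {ℓ})
    (Group.sym (ℤ₂ {c} {ℓ}) (_≈H_.≈G top-natural (swap≀ (XMod.G Y))))
    (_≈H_.≈G (α-zeroH≈idH {ℤ₂X}) (lift true))
    where
      ι : Hom X (Y ≀ℤ₂)
      ι = ι₁ {Y = Y} m
      zero : Hom X ℤ₂X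
      zero = zeroH
      top : Hom (Y ≀ℤ₂) ℤ₂X
      top = topH Y
      top∘ι≈zero : top ∘H ι ≈H zero
      top∘ι≈zero = (λ _ → _) , (λ _ → lift refl)
      top-natural : α zero ∘H top ≈H top ∘H α ι
      top-natural = α-natural-≈ ι top top∘ι≈zero

  swapImage : Group.Carrier (wreathℤ₂ X.G)
  swapImage = Hom.fG (α (ι₁ {Y = X} (idH X))) (swap≀ X.G)

  conjugator : X.G.Carrier
  conjugator = proj₂ (proj₁ swapImage) X.G.⁻¹

  α-ι₁-swap : {Y : XMod c ℓ} (m : Hom X Y) →
    Group._≈_ (wreathℤ₂ (XMod.G Y)) (Hom.fG (α (ι₁ {Y = Y} m)) (swap≀ (XMod.G Y)))
      ((Hom.fG m (proj₁ (proj₁ swapImage)) , Hom.fG m (proj₂ (proj₁ swapImage))) , lift true)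
  α-ι₁-swap {Y} m = begin
    Hom.fG (α ι) (swap≀ Y.G)
      ≈⟨ αι.fG-cong ((Y.G.sym M.fG-ε , Y.G.sym M.fG-ε) , lift refl) ⟩
    Hom.fG (α ι) (Hom.fG m≀ (swap≀ X.G))    ≈⟨ _≈H_.≈G naturality (swap≀ X.G) ⟩
    Hom.fG m≀ swapImage                     ≈⟨ (Y.G.refl , Y.G.refl) , α-ι₁-top (idH X) ⟩
    (Hom.fG m (proj₁ (proj₁ swapImage)) , Hom.fG m (proj₂ (proj₁ swapImage))) , lift true ∎
    where
      module Y = XMod Y
      module M = HomProperties m
      open SetoidReasoning (Group.setoid (wreathℤ₂ Y.G))
      ι : Hom X (Y ≀ℤ₂)
      ι = ι₁ {Y = Y} m
      ι-id : Hom X (X ≀ℤ₂)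
      ι-id = ι₁ {Y = X} (idH X)
      module αι = HomProperties (α ι)
      m≀ : Hom (X ≀ℤ₂) (Y ≀ℤ₂)
      m≀ = ≀ℤ₂-map {X = X} {Y = Y} m
      m≀∘ι-id≈ι : m≀ ∘H ι-id ≈H ι
      m≀∘ι-id≈ι = (λ a → Y.A.refl , M.fA-ε) , (λ g → (Y.G.refl , M.fG-ε) , lift refl)
      naturality : α ι ∘H m≀ ≈H m≀ ∘H α ι-id
      naturality = α-natural-≈ ι-id m≀ m≀∘ι-id≈ι

  module _ {Y : XMod c ℓ} (m : Hom X Y) where
    private
      module Y = XModProperties Y
      module W = Group (wreathℤ₂ Y.G)
      module M = HomProperties m
      module αm = HomProperties (α m)
      module αι = HomProperties (α (ι₁ {Y = Y} m))
      open Conjugation Y.G using (conj; conj-cong; conj-inverseˡ)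
      open GroupProperties Y.G using (inverseˡ-unique)

      P Q : Y.G.Carrier
      P = M.fG (proj₁ (proj₁ swapImage))
      Q = M.fG (proj₂ (proj₁ swapImage))

      conjugator-image : M.fG conjugator Y.G.≈ Q Y.G.⁻¹
      conjugator-image = M.fG-⁻¹ (proj₂ (proj₁ swapImage))

      αι-base-G : ∀ x y → αι.fG ((x , y) , lift false) W.≈ ((αm.fG x , y) , lift false)
      αι-base-G x y = _≈H_.≈G (α-ι₁-base m) (x , y)

      αι-base-A : ∀ a b → XMod.A._≈_ (Y ×X Y) (αι.fA (a , b)) (αm.fA a , b)
      αι-base-A a b = _≈H_.≈A (α-ι₁-base m) (a , b)

    -- Conjugating (h, ε) by the swap gives (ε, h); applying α (ι₁ m) turns this into an
    -- equation for α m h.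
    α-G-by-conjugator : ∀ h → conj (M.fG conjugator) h Y.G.≈ αm.fG h
    α-G-by-conjugator h = Y.G.trans (conj-cong conjugator-image h≈conj) (conj-inverseˡ Q a)
      where
        a : Y.G.Carrier
        a = αm.fG h
        σ C : W.Carrier
        σ = swap≀ Y.G
        C = (P , Q) , lift true
        swapped : ((Y.G.ε , h) , lift false) W.≈ (σ W.∙ ((h , Y.G.ε) , lift false)) W.∙ σ
        swapped = (Y.G.sym (Y.G.trans (Y.G.identityʳ _) (Y.G.identityˡ Y.G.ε))
                  , Y.G.sym (Y.G.trans (Y.G.identityʳ _) (Y.G.identityˡ h))) , lift refl
        key : ((Y.G.ε , h) , lift false) W.≈ (C W.∙ ((a , Y.G.ε) , lift false)) W.∙ C
        key = begin
          (Y.G.ε , h) , lift false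
            ≈⟨ (αm.fG-ε , Y.G.refl) , lift refl ⟨
          (αm.fG Y.G.ε , h) , lift false
            ≈⟨ αι-base-G Y.G.ε h ⟨
          αι.fG ((Y.G.ε , h) , lift false)
            ≈⟨ αι.fG-cong swapped ⟩
          αι.fG ((σ W.∙ ((h , Y.G.ε) , lift false)) W.∙ σ)
            ≈⟨ αι.fG-homo _ σ ⟩
          αι.fG (σ W.∙ ((h , Y.G.ε) , lift false)) W.∙ αι.fG σ
            ≈⟨ W.∙-congʳ (αι.fG-homo σ _) ⟩
          (αι.fG σ W.∙ αι.fG ((h , Y.G.ε) , lift false)) W.∙ αι.fG σ
            ≈⟨ W.∙-cong (W.∙-cong (α-ι₁-swap m) (αι-base-G h Y.G.ε)) (α-ι₁-swap m) ⟩
          (C W.∙ ((a , Y.G.ε) , lift false)) W.∙ C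
            ∎
          where open SetoidReasoning W.setoid
        P≈Q⁻¹ : P Y.G.≈ Q Y.G.⁻¹
        P≈Q⁻¹ = inverseˡ-unique P Q
          (Y.G.trans (Y.G.∙-congʳ (Y.G.sym (Y.G.identityʳ P))) (Y.G.sym (proj₁ (proj₁ key))))
        h≈conj : h Y.G.≈ conj Q a
        h≈conj = Y.G.trans (proj₂ (proj₁ key)) (Y.G.∙-congˡ P≈Q⁻¹)

    α-A-by-conjugator : ∀ b → Y.act (M.fG conjugator) b Y.A.≈ αm.fA b
    α-A-by-conjugator b = Y.A.trans (Y.act-cong conjugator-image (proj₂ key)) (Y.act-inverseˡ Q a)
      where
        module Y≀ = XMod (Y ≀ℤ₂)
        a : Y.A.Carrier
        a = αm.fA b
        σ : Y≀.G.Carrier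
        σ = swap≀ Y.G
        swapped : (Y.A.ε , b) Y≀.A.≈ Y≀.act σ (b , Y.A.ε)
        swapped = Y.A.sym (Y.act-ε Y.A.ε) , Y.A.sym (Y.act-ε b)
        key : (Y.A.ε , b) Y≀.A.≈ Y≀.act ((P , Q) , lift true) (a , Y.A.ε)
        key = begin
          Y.A.ε , b                                   ≈⟨ αm.fA-ε , Y.A.refl ⟨
          αm.fA Y.A.ε , b                             ≈⟨ αι-base-A Y.A.ε b ⟨
          αι.fA (Y.A.ε , b)                           ≈⟨ αι.fA-cong swapped ⟩
          αι.fA (Y≀.act σ (b , Y.A.ε))                ≈⟨ αι.comm-act σ (b , Y.A.ε) ⟩
          Y≀.act (αι.fG σ) (αι.fA (b , Y.A.ε))
                                          ≈⟨ Y≀.act-cong (α-ι₁-swap m) (αι-base-A b Y.A.ε) ⟩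
          Y≀.act ((P , Q) , lift true) (a , Y.A.ε)    ∎
          where open SetoidReasoning Y≀.A.setoid

  innerIsotropy-conjugator : _≈I_ X (innerIsotropy conjugator) φ
  innerIsotropy-conjugator m = α-A-by-conjugator m , α-G-by-conjugator m

module _ {X : XMod c ℓ} where
  private
    module X where
      open XMod X public
      open GroupProperties G public using (⁻¹-involutive)
    open IsotropyProperties using (conjugator; innerIsotropy-conjugator)

  conjugator-cong : {φ ψ : Isotropy X} → _≈I_ X φ ψ → conjugator φ X.G.≈ conjugator ψ
  conjugator-cong φ≈ψ =
    X.G.⁻¹-cong (proj₂ (proj₁ (_≈H_.≈G (φ≈ψ (ι₁ {Y = X} (idH X))) (swap≀ X.G))))

  -- The swap image for innerIsotropy g has second coordinate (ε ∙ ε) ∙ g⁻¹.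
  conjugator-innerIsotropy : (g : X.G.Carrier) → conjugator (innerIsotropy {X = X} g) X.G.≈ g
  conjugator-innerIsotropy g = X.G.trans
    (X.G.⁻¹-cong (X.G.trans (X.G.∙-congʳ (X.G.identityˡ X.G.ε)) (X.G.identityˡ (g X.G.⁻¹))))
    (X.⁻¹-involutive g)

  innerIsotropy-isGroupHomomorphism :
    GroupMorphisms.IsGroupHomomorphism X.G.rawGroup (IsotropyGroup X) innerIsotropy
  innerIsotropy-isGroupHomomorphism = record
    { isMonoidHomomorphism = record
      { isMagmaHomomorphism = record
        { isRelHomomorphism = record
          { cong = λ g≈g' m → innerH-cong (HomProperties.fG-cong m g≈g') }
        ; homo = λ g g' m →
            ≈H-trans (innerH-cong (HomProperties.fG-homo m g g')) (≈H-sym (innerH-∙ _ _)) }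
      ; ε-homo = λ m → innerH-ε (HomProperties.fG-ε m) }
    ; ⁻¹-homo = λ g m → ≈H-refl }

  innerIsotropy-injective : Injective X.G._≈_ (_≈I_ X) innerIsotropy
  innerIsotropy-injective {g} {g'} inner≈inner = begin
    g                                       ≈⟨ conjugator-innerIsotropy g ⟨
    conjugator (innerIsotropy {X = X} g)
      ≈⟨ conjugator-cong {innerIsotropy g} {innerIsotropy g'} inner≈inner ⟩
    conjugator (innerIsotropy {X = X} g')   ≈⟨ conjugator-innerIsotropy g' ⟩
    g'                                      ∎
    where open SetoidReasoning X.G.setoid

  innerIsotropy-surjective : Surjective X.G._≈_ (_≈I_ X) innerIsotropy
  innerIsotropy-surjective φ = conjugator φ , λ g≈conjugator m →
    ≈H-trans (innerH-cong (HomProperties.fG-cong m g≈conjugator)) (innerIsotropy-conjugator φ m)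

proposition17 : {c ℓ : Level} (X : XMod c ℓ) →
    Σ (Group.Carrier (XMod.G X) → Isotropy X)
    (GroupMorphisms.IsGroupIsomorphism (Group.rawGroup (XMod.G X)) (IsotropyGroup X))
proposition17 X = innerIsotropy , record
  { isGroupMonomorphism = record
    { isGroupHomomorphism = innerIsotropy-isGroupHomomorphism
    ; injective = innerIsotropy-injective }
  ; surjective = innerIsotropy-surjective }
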